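{- Every hereditary $2$-clique is Gallai, i.e., contains no triangle whose three edges have three distinct colors.
   Context: A clique is a complete subgraph induced by a nonempty vertex set, with the restricted edge coloring. A partition of a clique into nonempty disjoint subcliques is a $2$-partition if all edges joining distinct blocks use at most two colors in total, and is homogeneous if for any two distinct blocks all edges between them have the same color. Hereditary $2$-cliques are defined inductively (least class): every singleton clique is one, and a clique admitting a homogeneous $2$-partition whose blocks are hereditary $2$-cliques is one. -}

module Defs where

open import Data.Nat using (ℕ)
open import Data.Fin using (Fin)
open import Data.Fin.Subset using (Subset; _∈_; ⁅_⁆; Nonempty)
open import Data.Product using (Σ; _×_; ∃)
open import Data.Sum using (_⊎_)
open import Data.Empty using (⊥)
open import Relation.Binary.PropositionalEquality using (_≡_; _≢_)

-- An edge-coloured complete graph K_n: vertices Fin n, colours in an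
-- arbitrary type C, colouring of edges given by a symmetric function
-- (only its values on pairs u ≢ v are meaningful).
SymmetricColouring : {C : Set} {n : ℕ} → (Fin n → Fin n → C) → Set
SymmetricColouring {n = n} c = (u v : Fin n) → u ≢ v → c u v ≡ c v u

module _ {C : Set} {n : ℕ} (c : Fin n → Fin n → C) where

  record HomogeneousTwoPartition (S : Subset n) : Set where
    field
      k          : ℕ
      block      : Fin k → Subset n
      nonempty   : (i : Fin k) → Nonempty (block i)
      inside     : (i : Fin k) (v : Fin n) → v ∈ block i → v ∈ S
      covers     : (v : Fin n) → v ∈ S → ∃ λ i → v ∈ block i
      disjoint   : (i j : Fin k) (v : Fin n) → v ∈ block i → v ∈ block j → i ≡ j
      twoColours : Σ C λ a → Σ C λ b →
                     (i j : Fin k) → i ≢ j → (u v : Fin n) →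
                     u ∈ block i → v ∈ block j → (c u v ≡ a ⊎ c u v ≡ b)
      homogeneous : (i j : Fin k) → i ≢ j → Σ C λ col →
                     (u v : Fin n) → u ∈ block i → v ∈ block j → c u v ≡ col

  data Hereditary2Clique : Subset n → Set where
    singleton : (v : Fin n) → Hereditary2Clique ⁅ v ⁆
    glue      : {S : Subset n} (P : HomogeneousTwoPartition S) →
                ((i : Fin (HomogeneousTwoPartition.k P)) →
                   Hereditary2Clique (HomogeneousTwoPartition.block P i)) →
                Hereditary2Clique S

  Gallai : Subset n → Set
  Gallai S = (x y z : Fin n) → x ∈ S → y ∈ S → z ∈ S →
             x ≢ y → y ≢ z → x ≢ z →
             ¬Rainbow x y z
    where
    ¬Rainbow : Fin n → Fin n → Fin n → Set
    ¬Rainbow x y z = (c x y ≢ c y z × c y z ≢ c x z × c x y ≢ c x z) → ⊥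

-- A rainbow triangle of a glued clique cannot meet two blocks: if exactly two of
-- its vertices share a block, homogeneity gives both edges to the third vertex
-- the same colour; if all three lie in distinct blocks, its three colours are
-- drawn from the two colours of the 2-partition. Hence it lies inside one block,
-- and induction on the hereditary structure ends at a singleton, which has no
-- triangle at all.
module Submission where

open import Defs
open import Data.Nat using (ℕ)
open import Data.Fin using (Fin; _≟_)
open import Data.Fin.Subset using (Subset; _∈_)
open import Data.Fin.Subset.Properties using (x∈⁅y⁆⇒x≡y)
open import Data.Product using (_×_; _,_)
open import Data.Sum using (_⊎_; inj₁; inj₂)
open import Data.Empty using (⊥; ⊥-elim)
open import Function using (_∘_)
open import Relation.Nullary using (yes; no)
open import Relation.Binary.PropositionalEquality using (_≡_; _≢_; refl; sym; trans)

two-valued-not-pairwise-distinct : {A : Set} {a b p q r : A} →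
  (p ≡ a ⊎ p ≡ b) → (q ≡ a ⊎ q ≡ b) → (r ≡ a ⊎ r ≡ b) →
  p ≢ q → q ≢ r → p ≢ r → ⊥
two-valued-not-pairwise-distinct (inj₁ p≡a) (inj₁ q≡a) _ p≢q _ _ = p≢q (trans p≡a (sym q≡a))
two-valued-not-pairwise-distinct (inj₂ p≡b) (inj₂ q≡b) _ p≢q _ _ = p≢q (trans p≡b (sym q≡b))
two-valued-not-pairwise-distinct (inj₁ p≡a) (inj₂ _) (inj₁ r≡a) _ _ p≢r = p≢r (trans p≡a (sym r≡a))
two-valued-not-pairwise-distinct (inj₁ _) (inj₂ q≡b) (inj₂ r≡b) _ q≢r _ = q≢r (trans q≡b (sym r≡b))
two-valued-not-pairwise-distinct (inj₂ _) (inj₁ q≡a) (inj₁ r≡a) _ q≢r _ = q≢r (trans q≡a (sym r≡a))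
two-valued-not-pairwise-distinct (inj₂ p≡b) (inj₁ _) (inj₂ r≡b) _ _ p≢r = p≢r (trans p≡b (sym r≡b))

module _ {C : Set} {n : ℕ} (c : Fin n → Fin n → C) where

  Rainbow : Fin n → Fin n → Fin n → Set
  Rainbow x y z = c x y ≢ c y z × c y z ≢ c x z × c x y ≢ c x z

  module _ {S : Subset n} (P : HomogeneousTwoPartition c S) where
    open HomogeneousTwoPartition P

    colour-between-blocks : {i j : Fin k} {u u′ v v′ : Fin n} → i ≢ j →
      u ∈ block i → u′ ∈ block i → v ∈ block j → v′ ∈ block j → c u v ≡ c u′ v′
    colour-between-blocks i≢j u∈i u′∈i v∈j v′∈j with homogeneous _ _ i≢j
    ... | _ , monochrome = trans (monochrome _ _ u∈i v∈j) (sym (monochrome _ _ u′∈i v′∈j))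

    rainbow-within-block : SymmetricColouring c → {x y z : Fin n} {i j l : Fin k} →
      y ≢ z → Rainbow x y z →
      x ∈ block i → y ∈ block j → z ∈ block l → i ≡ j × j ≡ l
    rainbow-within-block c-sym {x} {y} {z} {i} {j} {l} y≢z (xy≢yz , yz≢xz , xy≢xz) x∈i y∈j z∈l
      with i ≟ j | j ≟ l
    ... | yes i≡j | yes j≡l = i≡j , j≡l
    ... | yes refl | no j≢l = ⊥-elim (yz≢xz (colour-between-blocks j≢l y∈j x∈i z∈l z∈l))
    ... | no i≢j | yes refl = ⊥-elim (xy≢xz (colour-between-blocks i≢j x∈i x∈i y∈j z∈l))
    ... | no i≢j | no j≢l with i ≟ l
    ...   | yes refl = ⊥-elim (xy≢yz (trans (colour-between-blocks i≢j x∈i z∈l y∈j y∈j)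
                                            (c-sym z y (y≢z ∘ sym))))
    ...   | no i≢l with twoColours
    ...     | _ , _ , twoColoured = ⊥-elim (two-valued-not-pairwise-distinct
                (twoColoured i j i≢j x y x∈i y∈j)
                (twoColoured j l j≢l y z y∈j z∈l)
                (twoColoured i l i≢l x z x∈i z∈l)
                xy≢yz yz≢xz xy≢xz)

corollary12 : {C : Set} {n : ℕ} (c : Fin n → Fin n → C) →
              SymmetricColouring c →
              (S : Subset n) → Hereditary2Clique c S → Gallai c S
corollary12 c c-sym _ (singleton v) x y _ x∈S y∈S _ x≢y _ _ _ =
  x≢y (trans (x∈⁅y⁆⇒x≡y v x∈S) (sym (x∈⁅y⁆⇒x≡y v y∈S)))
corollary12 c c-sym _ (glue P blocks-hereditary) x y z x∈S y∈S z∈S x≢y y≢z x≢z rainbow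
  with covers x x∈S | covers y y∈S | covers z z∈S
  where open HomogeneousTwoPartition P
... | i , x∈i | j , y∈j | l , z∈l
  with rainbow-within-block c P c-sym y≢z rainbow x∈i y∈j z∈l
... | refl , refl =
  corollary12 c c-sym _ (blocks-hereditary i) x y z x∈i y∈j z∈l x≢y y≢z x≢z rainbow
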